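{- The category $\mathfrak{H}$ of set-system hypergraphs is not cartesian closed, and the edge functor $E:\mathfrak{H}\to\mathbf{Set}$ is not continuous (does not preserve all limits).
   Context: A set-system hypergraph $G$ consists of sets $V(G)$, $E(G)$ and a function $\epsilon_G:E(G)\to\mathcal{P}(V(G))$ (edges may be empty). A morphism $\phi:G\to H$ is a pair of functions $V(\phi):V(G)\to V(H)$, $E(\phi):E(G)\to E(H)$ with $\epsilon_H\circ E(\phi)=\mathcal{P}V(\phi)\circ\epsilon_G$, where $\mathcal{P}f(A)=\{f(a):a\in A\}$. This forms the category $\mathfrak{H}$. The functor $E$ sends $G$ to $E(G)$ and $\phi$ to $E(\phi)$. -}

module Defs where

open import Level using (Level; _⊔_; 0ℓ) renaming (suc to lsuc)
open import Relation.Binary.PropositionalEquality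
  using (_≡_; refl; sym; trans; cong; isEquivalence)
open import Relation.Binary.Structures using (IsEquivalence)
open import Data.Product using (Σ; _×_; _,_; proj₁; proj₂)
open import Function.Bundles using (_⇔_; mk⇔; Equivalence)
open import Relation.Nullary using (¬_)

-- Minimal category theory (hom-setoids, as usual in Agda without funext)

record Category (o ℓ e : Level) : Set (lsuc (o ⊔ ℓ ⊔ e)) where
  infix  4 _≈_
  infixr 9 _∘_
  field
    Obj      : Set o
    _⇒_      : Obj → Obj → Set ℓ
    _≈_      : ∀ {A B} → A ⇒ B → A ⇒ B → Set e
    id       : ∀ {A} → A ⇒ A
    _∘_      : ∀ {A B C} → B ⇒ C → A ⇒ B → A ⇒ C
    equiv    : ∀ {A B} → IsEquivalence (_≈_ {A} {B})
    ∘-resp-≈ : ∀ {A B C} {f h : B ⇒ C} {g i : A ⇒ B} →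
               f ≈ h → g ≈ i → f ∘ g ≈ h ∘ i
    identityˡ : ∀ {A B} {f : A ⇒ B} → id ∘ f ≈ f
    identityʳ : ∀ {A B} {f : A ⇒ B} → f ∘ id ≈ f
    assoc    : ∀ {A B C D} {f : A ⇒ B} {g : B ⇒ C} {h : C ⇒ D} →
               (h ∘ g) ∘ f ≈ h ∘ (g ∘ f)

record Functor {o ℓ e o′ ℓ′ e′ : Level}
       (C : Category o ℓ e) (D : Category o′ ℓ′ e′)
       : Set (o ⊔ ℓ ⊔ e ⊔ o′ ⊔ ℓ′ ⊔ e′) where
  private
    module C = Category C
    module D = Category D
  field
    F₀ : C.Obj → D.Obj
    F₁ : ∀ {A B} → A C.⇒ B → F₀ A D.⇒ F₀ B
    identity     : ∀ {A} → F₁ (C.id {A}) D.≈ D.id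
    homomorphism : ∀ {A B C′} {f : A C.⇒ B} {g : B C.⇒ C′} →
                   F₁ (g C.∘ f) D.≈ F₁ g D.∘ F₁ f
    F-resp-≈     : ∀ {A B} {f g : A C.⇒ B} → f C.≈ g → F₁ f D.≈ F₁ g

_∘F_ : ∀ {o ℓ e o′ ℓ′ e′ o″ ℓ″ e″}
       {C : Category o ℓ e} {D : Category o′ ℓ′ e′} {K : Category o″ ℓ″ e″} →
       Functor D K → Functor C D → Functor C K
_∘F_ {K = K} F G = record
  { F₀ = λ A → F.F₀ (G.F₀ A)
  ; F₁ = λ f → F.F₁ (G.F₁ f)
  ; identity = K.≈trans (F.F-resp-≈ G.identity) F.identity
  ; homomorphism = K.≈trans (F.F-resp-≈ G.homomorphism) F.homomorphism
  ; F-resp-≈ = λ p → F.F-resp-≈ (G.F-resp-≈ p)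
  }
  where
  module F = Functor F
  module G = Functor G
  module K where
    open Category K public
    ≈trans : ∀ {A B} {f g h : A ⇒ B} → f ≈ g → g ≈ h → f ≈ h
    ≈trans = IsEquivalence.trans equiv

module _ {o ℓ e : Level} (C : Category o ℓ e) where
  open Category C

  record Terminal : Set (o ⊔ ℓ ⊔ e) where
    field
      ⊤        : Obj
      !        : ∀ {X} → X ⇒ ⊤
      !-unique : ∀ {X} (f : X ⇒ ⊤) → ! ≈ f

  record Product (A B : Obj) : Set (o ⊔ ℓ ⊔ e) where
    field
      A×B      : Obj
      π₁       : A×B ⇒ A
      π₂       : A×B ⇒ B
      ⟨_,_⟩    : ∀ {X} → X ⇒ A → X ⇒ B → X ⇒ A×B
      project₁ : ∀ {X} {f : X ⇒ A} {g : X ⇒ B} → π₁ ∘ ⟨ f , g ⟩ ≈ f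
      project₂ : ∀ {X} {f : X ⇒ A} {g : X ⇒ B} → π₂ ∘ ⟨ f , g ⟩ ≈ g
      unique   : ∀ {X} {h : X ⇒ A×B} {f : X ⇒ A} {g : X ⇒ B} →
                 π₁ ∘ h ≈ f → π₂ ∘ h ≈ g → ⟨ f , g ⟩ ≈ h

  record Exponential (prod : ∀ X Y → Product X Y) (A B : Obj) : Set (o ⊔ ℓ ⊔ e) where
    private
      module P X = Product (prod X A)
    field
      B^A  : Obj
      eval : P.A×B B^A ⇒ B
    _×id : ∀ {X} → X ⇒ B^A → P.A×B X ⇒ P.A×B B^A
    _×id {X} h = P.⟨_,_⟩ B^A (h ∘ P.π₁ X) (P.π₂ X)
    field
      λg      : ∀ {X} → P.A×B X ⇒ B → X ⇒ B^A
      β       : ∀ {X} {f : P.A×B X ⇒ B} → eval ∘ (λg f ×id) ≈ f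
      λ-unique : ∀ {X} {f : P.A×B X ⇒ B} {h : X ⇒ B^A} →
                 eval ∘ (h ×id) ≈ f → h ≈ λg f

  record CartesianClosed : Set (o ⊔ ℓ ⊔ e) where
    field
      terminal    : Terminal
      product     : ∀ A B → Product A B
      exponential : ∀ A B → Exponential product A B

module _ {o ℓ e o′ ℓ′ e′ : Level} {J : Category o′ ℓ′ e′} {C : Category o ℓ e}
         (D : Functor J C) where
  private
    module J = Category J
  open Category C
  open Functor D

  record Cone : Set (o ⊔ ℓ ⊔ e ⊔ o′ ⊔ ℓ′) where
    field
      apex    : Obj
      ψ       : ∀ j → apex ⇒ F₀ j
      commute : ∀ {i j} (f : i J.⇒ j) → F₁ f ∘ ψ i ≈ ψ j

  IsLimit : Cone → Set (o ⊔ ℓ ⊔ e ⊔ o′ ⊔ ℓ′)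
  IsLimit L = ∀ (K : Cone) →
    Σ (Cone.apex K ⇒ Cone.apex L) λ h →
      (∀ j → Cone.ψ L j ∘ h ≈ Cone.ψ K j) ×
      (∀ (h′ : Cone.apex K ⇒ Cone.apex L) →
         (∀ j → Cone.ψ L j ∘ h′ ≈ Cone.ψ K j) → h′ ≈ h)

mapCone : ∀ {o ℓ e o′ ℓ′ e′ o″ ℓ″ e″}
          {J : Category o′ ℓ′ e′} {C : Category o ℓ e} {K : Category o″ ℓ″ e″}
          (F : Functor C K) {D : Functor J C} → Cone D → Cone (F ∘F D)
mapCone {K = K} F {D} c = record
  { apex = F.F₀ (Cone.apex c)
  ; ψ = λ j → F.F₁ (Cone.ψ c j)
  ; commute = λ f → IsEquivalence.trans (Category.equiv K)
      (IsEquivalence.sym (Category.equiv K) F.homomorphism)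
      (F.F-resp-≈ (Cone.commute c f))
  }
  where module F = Functor F

-- F is continuous: preserves all small limits (diagrams indexed by
-- small categories, i.e. with Obj, hom-sets and hom-equalities in Set).
Continuous : ∀ {o ℓ e o″ ℓ″ e″} {C : Category o ℓ e} {K : Category o″ ℓ″ e″} →
             Functor C K → Set _
Continuous {C = C} F =
  ∀ (J : Category 0ℓ 0ℓ 0ℓ) (D : Functor J C) (L : Cone D) →
  IsLimit D L → IsLimit (F ∘F D) (mapCone F L)

SetCat : Category (lsuc 0ℓ) 0ℓ 0ℓ
SetCat = record
  { Obj = Set
  ; _⇒_ = λ A B → A → B
  ; _≈_ = λ f g → ∀ x → f x ≡ g x
  ; id = λ x → x
  ; _∘_ = λ g f x → g (f x)
  ; equiv = record { refl = λ _ → refl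
                   ; sym = λ p x → sym (p x)
                   ; trans = λ p q x → trans (p x) (q x) }
  ; ∘-resp-≈ = λ {f = f} {i = i} p q x → trans (cong f (q x)) (p (i x))
  ; identityˡ = λ _ → refl
  ; identityʳ = λ _ → refl
  ; assoc = λ _ → refl
  }

-- Subsets of A are predicates A → Set; two subsets are equal when they
-- have the same elements.
𝒫 : Set → Set₁
𝒫 A = A → Set

𝒫map : ∀ {A B : Set} → (A → B) → 𝒫 A → 𝒫 B
𝒫map f X b = Σ _ λ a → X a × f a ≡ b

_≐_ : ∀ {A : Set} → 𝒫 A → 𝒫 A → Set
X ≐ Y = ∀ a → X a ⇔ Y a

record Hypergraph : Set₁ where
  field
    V : Set
    E : Set
    ε : E → 𝒫 V

record Hom (G H : Hypergraph) : Set where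
  private
    module G = Hypergraph G
    module H = Hypergraph H
  field
    V⟨_⟩  : G.V → H.V
    E⟨_⟩  : G.E → H.E
    comm : ∀ e → H.ε (E⟨_⟩ e) ≐ 𝒫map V⟨_⟩ (G.ε e)
open Hom public

_≈H_ : ∀ {G H} → Hom G H → Hom G H → Set
φ ≈H ψ = (∀ v → V⟨ φ ⟩ v ≡ V⟨ ψ ⟩ v) × (∀ e → E⟨ φ ⟩ e ≡ E⟨ ψ ⟩ e)

idH : ∀ {G} → Hom G G
idH {G} = record
  { V⟨_⟩ = λ v → v
  ; E⟨_⟩ = λ e → e
  ; comm = λ e v → mk⇔ (λ x → v , x , refl) (λ { (_ , x , refl) → x })
  }

_∘H_ : ∀ {G H K} → Hom H K → Hom G H → Hom G K
_∘H_ {G} {H} {K} ψ φ = record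
  { V⟨_⟩ = λ v → V⟨ ψ ⟩ (V⟨ φ ⟩ v)
  ; E⟨_⟩ = λ e → E⟨ ψ ⟩ (E⟨ φ ⟩ e)
  ; comm = λ e v → mk⇔ (to e v) (from e v)
  }
  where
  to : ∀ e v → Hypergraph.ε K (E⟨ ψ ⟩ (E⟨ φ ⟩ e)) v →
       𝒫map (λ x → V⟨ ψ ⟩ (V⟨ φ ⟩ x)) (Hypergraph.ε G e) v
  to e v x with Equivalence.to (comm ψ (E⟨ φ ⟩ e) v) x
  ... | h , hx , refl with Equivalence.to (comm φ e h) hx
  ... | g , gx , refl = g , gx , refl
  from : ∀ e v → 𝒫map (λ x → V⟨ ψ ⟩ (V⟨ φ ⟩ x)) (Hypergraph.ε G e) v →
         Hypergraph.ε K (E⟨ ψ ⟩ (E⟨ φ ⟩ e)) v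
  from e v (g , gx , refl) =
    Equivalence.from (comm ψ (E⟨ φ ⟩ e) v)
      (V⟨ φ ⟩ g , Equivalence.from (comm φ e (V⟨ φ ⟩ g)) (g , gx , refl) , refl)

ℌ : Category (lsuc 0ℓ) 0ℓ 0ℓ
ℌ = record
  { Obj = Hypergraph
  ; _⇒_ = Hom
  ; _≈_ = _≈H_
  ; id = idH
  ; _∘_ = _∘H_
  ; equiv = record
      { refl = (λ _ → refl) , (λ _ → refl)
      ; sym = λ (p , q) → (λ v → sym (p v)) , (λ e → sym (q e))
      ; trans = λ (p , q) (p′ , q′) → (λ v → trans (p v) (p′ v)) , (λ e → trans (q e) (q′ e))
      }
  ; ∘-resp-≈ = λ {f = f} {i = i} (p , q) (p′ , q′) →
      (λ v → trans (cong V⟨ f ⟩ (p′ v)) (p (V⟨ i ⟩ v))) ,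
      (λ e → trans (cong E⟨ f ⟩ (q′ e)) (q (E⟨ i ⟩ e)))
  ; identityˡ = (λ _ → refl) , (λ _ → refl)
  ; identityʳ = (λ _ → refl) , (λ _ → refl)
  ; assoc = (λ _ → refl) , (λ _ → refl)
  }

EdgeFunctor : Functor ℌ SetCat
EdgeFunctor = record
  { F₀ = Hypergraph.E
  ; F₁ = E⟨_⟩
  ; identity = λ _ → refl
  ; homomorphism = λ _ → refl
  ; F-resp-≈ = proj₂
  }

module Submission where

-- Let Edge₂ be two vertices joined by one full edge
-- and P = Edge₂ × Edge₂.  Collapsing the vertices of P along the second
-- projection (keeping every edge) gives a morphism f : P → B that is the
-- identity on edges.  Probing with edgeless one-vertex hypergraphs shows the
-- transpose λf : Edge₂ → B^Edge₂ is constant on vertices, so it factors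
-- through the terminal hypergraph One, and hence f factors through
-- ! × Edge₂ : P → One × Edge₂.  But One × Edge₂ has only one edge, so f
-- identifies the diagonal and the antidiagonal edge of P, which are distinct.
--
-- The group ℤ₂ acts on Edge₂ by swapping the vertices.  A
-- cone over this action can have no vertex (it would be a fixed point) and
-- hence no edge, so the empty hypergraph is its limit; the edge sets, however,
-- form the trivial action on a point, whose limit is a point.

open import Level using (Level; 0ℓ)
open import Data.Bool using (Bool; true; false; not; _xor_)
open import Data.Bool.Properties using (not-¬; xor-assoc; xor-identityʳ; xor-same)
open import Data.Unit using (⊤; tt)
open import Data.Empty using (⊥; ⊥-elim)
open import Data.Product using (Σ; _×_; _,_; proj₁; proj₂)
open import Function.Bundles using (mk⇔; Equivalence)
open import Relation.Nullary using (¬_)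
open import Relation.Binary.Bundles using (Setoid)
open import Relation.Binary.Structures using (IsEquivalence)
open import Relation.Binary.PropositionalEquality
  using (_≡_; refl; sym; trans; cong; cong₂; subst; isEquivalence)
import Relation.Binary.Reasoning.Setoid as SetoidReasoning

open import Defs

module CategoryFacts {o ℓ e : Level} (C : Category o ℓ e) where
  open Category C

  hom-setoid : ∀ {A B : Obj} → Setoid ℓ e
  hom-setoid {A} {B} = record
    { Carrier = A ⇒ B ; _≈_ = _≈_ ; isEquivalence = equiv }

  module HomReasoning {A B : Obj} = SetoidReasoning (hom-setoid {A} {B})

  ≈-refl : ∀ {A B} {f : A ⇒ B} → f ≈ f
  ≈-refl = IsEquivalence.refl equiv

  ≈-sym : ∀ {A B} {f g : A ⇒ B} → f ≈ g → g ≈ f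
  ≈-sym = IsEquivalence.sym equiv

  product-ext : ∀ {A B X} (P : Product C A B) {φ ψ : X ⇒ Product.A×B P} →
                Product.π₁ P ∘ φ ≈ Product.π₁ P ∘ ψ →
                Product.π₂ P ∘ φ ≈ Product.π₂ P ∘ ψ → φ ≈ ψ
  product-ext P {φ} {ψ} p₁ p₂ = begin
      φ                    ≈⟨ ≈-sym (unique ≈-refl ≈-refl) ⟩
      ⟨ π₁ ∘ φ , π₂ ∘ φ ⟩  ≈⟨ unique (≈-sym p₁) (≈-sym p₂) ⟩
      ψ                    ∎
    where
    open Product P
    open HomReasoning

  module WithProducts (prod : ∀ X Y → Product C X Y) where
    private
      module P X Y = Product (prod X Y)
    open P using (π₁; π₂; ⟨_,_⟩; project₁; project₂; unique) public

    -- h × id_A; definitionally the same map as Exponential._×id.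
    _⊗_ : ∀ {X Y} → X ⇒ Y → (A : Obj) → P.A×B X A ⇒ P.A×B Y A
    _⊗_ {X} {Y} h A = ⟨ Y , A ⟩ (h ∘ π₁ X A) (π₂ X A)

    ⊗-resp-≈ : ∀ {X Y A} {h h′ : X ⇒ Y} → h ≈ h′ → h ⊗ A ≈ h′ ⊗ A
    ⊗-resp-≈ {X} {Y} {A} h≈h′ = unique Y A
      (IsEquivalence.trans equiv (project₁ Y A) (∘-resp-≈ (≈-sym h≈h′) ≈-refl))
      (project₂ Y A)

    ⊗-∘ : ∀ {X Y Z A} {g : X ⇒ Y} {h : Y ⇒ Z} →
          (h ∘ g) ⊗ A ≈ (h ⊗ A) ∘ (g ⊗ A)
    ⊗-∘ {X} {Y} {Z} {A} {g} {h} = unique Z A first second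
      where
      open HomReasoning
      first : π₁ Z A ∘ ((h ⊗ A) ∘ (g ⊗ A)) ≈ (h ∘ g) ∘ π₁ X A
      first = begin
        π₁ Z A ∘ ((h ⊗ A) ∘ (g ⊗ A))  ≈⟨ ≈-sym assoc ⟩
        (π₁ Z A ∘ (h ⊗ A)) ∘ (g ⊗ A)  ≈⟨ ∘-resp-≈ (project₁ Z A) ≈-refl ⟩
        (h ∘ π₁ Y A) ∘ (g ⊗ A)        ≈⟨ assoc ⟩
        h ∘ (π₁ Y A ∘ (g ⊗ A))        ≈⟨ ∘-resp-≈ ≈-refl (project₁ Y A) ⟩
        h ∘ (g ∘ π₁ X A)              ≈⟨ ≈-sym assoc ⟩
        (h ∘ g) ∘ π₁ X A              ∎
      second : π₂ Z A ∘ ((h ⊗ A) ∘ (g ⊗ A)) ≈ π₂ X A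
      second = begin
        π₂ Z A ∘ ((h ⊗ A) ∘ (g ⊗ A))  ≈⟨ ≈-sym assoc ⟩
        (π₂ Z A ∘ (h ⊗ A)) ∘ (g ⊗ A)  ≈⟨ ∘-resp-≈ (project₂ Z A) ≈-refl ⟩
        π₂ Y A ∘ (g ⊗ A)              ≈⟨ project₂ Y A ⟩
        π₂ X A                        ∎

    module WithExponential {A B : Obj} (Ex : Exponential C prod A B) where
      open Exponential Ex

      λ-natural : ∀ {X Y} {f : P.A×B Y A ⇒ B} (p : X ⇒ Y) →
                  λg f ∘ p ≈ λg (f ∘ (p ⊗ A))
      λ-natural {f = f} p = λ-unique (begin
        eval ∘ ((λg f ∘ p) ⊗ A)            ≈⟨ ∘-resp-≈ ≈-refl ⊗-∘ ⟩
        eval ∘ ((λg f ⊗ A) ∘ (p ⊗ A))      ≈⟨ ≈-sym assoc ⟩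
        (eval ∘ (λg f ⊗ A)) ∘ (p ⊗ A)      ≈⟨ ∘-resp-≈ β ≈-refl ⟩
        f ∘ (p ⊗ A)                        ∎)
        where open HomReasoning

      λ-equalises : ∀ {X Y} {f : P.A×B Y A ⇒ B} (p p′ : X ⇒ Y) →
                    f ∘ (p ⊗ A) ≈ f ∘ (p′ ⊗ A) → λg f ∘ p ≈ λg f ∘ p′
      λ-equalises {f = f} p p′ same = begin
        λg f ∘ p                ≈⟨ λ-natural p ⟩
        λg (f ∘ (p ⊗ A))        ≈⟨ λ-unique (IsEquivalence.trans equiv β same) ⟩
        λg (f ∘ (p′ ⊗ A))       ≈⟨ ≈-sym (λ-natural p′) ⟩
        λg f ∘ p′               ∎
        where open HomReasoning

      β-factor : ∀ {X Y} {f : P.A×B X A ⇒ B} {q : X ⇒ Y} {k : Y ⇒ B^A} →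
                 λg f ≈ k ∘ q → f ≈ (eval ∘ (k ⊗ A)) ∘ (q ⊗ A)
      β-factor {f = f} {q} {k} λf≈kq = begin
        f                              ≈⟨ ≈-sym β ⟩
        eval ∘ (λg f ⊗ A)              ≈⟨ ∘-resp-≈ ≈-refl (⊗-resp-≈ λf≈kq) ⟩
        eval ∘ ((k ∘ q) ⊗ A)           ≈⟨ ∘-resp-≈ ≈-refl ⊗-∘ ⟩
        eval ∘ ((k ⊗ A) ∘ (q ⊗ A))     ≈⟨ ≈-sym assoc ⟩
        (eval ∘ (k ⊗ A)) ∘ (q ⊗ A)     ∎
        where open HomReasoning

open CategoryFacts ℌ using (product-ext; module WithProducts)

open Hypergraph

IsFull : (X : Hypergraph) → E X → Set
IsFull X w = ∀ v → ε X w v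

Complete : Set → Hypergraph
Complete S = record { V = S ; E = ⊤ ; ε = λ _ _ → ⊤ }

One : Hypergraph
One = Complete ⊤

Edge₂ : Hypergraph
Edge₂ = Complete Bool

completeHom : ∀ {S X} (g : S → V X) (w : E X) →
              (∀ v → ε X w v → Σ S λ s → g s ≡ v) → (∀ s → ε X w (g s)) →
              Hom (Complete S) X
completeHom g w onto into = record
  { V⟨_⟩ = g
  ; E⟨_⟩ = λ _ → w
  ; comm = λ _ v → mk⇔ (λ x → proj₁ (onto v x) , tt , proj₂ (onto v x))
                       (λ { (s , _ , refl) → into s })
  }

fullEdge : ∀ {X} (w : E X) → IsFull X w → Hom (Complete (V X)) X
fullEdge w full = completeHom (λ v → v) w (λ v _ → v , refl) full

! : Hom Edge₂ One
! = completeHom (λ _ → tt) tt (λ _ _ → true , refl) (λ _ → tt)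

factor-through-One : ∀ {X} (φ : Hom Edge₂ X) → V⟨ φ ⟩ true ≡ V⟨ φ ⟩ false →
                     Σ (Hom One X) λ k → φ ≈H (k ∘H !)
factor-through-One {X} φ constant = k , constant-on , (λ _ → refl)
  where
  constant-on : ∀ b → V⟨ φ ⟩ b ≡ V⟨ φ ⟩ true
  constant-on true  = refl
  constant-on false = sym constant
  k : Hom One X
  k = completeHom (λ _ → V⟨ φ ⟩ true) (E⟨ φ ⟩ tt)
    (λ v x → let (b , _ , φb≡v) = Equivalence.to (comm φ tt v) x
             in tt , trans (sym (constant-on b)) φb≡v)
    (λ _ → Equivalence.from (comm φ tt _) (true , tt , refl))

Point : Hypergraph
Point = record { V = ⊤ ; E = ⊥ ; ε = λ () }

point : ∀ {X} → V X → Hom Point X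
point x = record { V⟨_⟩ = λ _ → x ; E⟨_⟩ = λ () ; comm = λ () }

edgeless-ext : ∀ {X Y} {φ ψ : Hom X Y} → (E X → ⊥) →
               (∀ v → V⟨ φ ⟩ v ≡ V⟨ ψ ⟩ v) → φ ≈H ψ
edgeless-ext noEdge same = same , λ e → ⊥-elim (noEdge e)

pushV : (X : Hypergraph) {W : Set} → (V X → W) → Hypergraph
pushV X {W} g = record { V = W ; E = E X ; ε = λ e → 𝒫map g (ε X e) }

pushHom : ∀ X {W} (g : V X → W) → Hom X (pushV X g)
pushHom X g = record
  { V⟨_⟩ = g ; E⟨_⟩ = λ e → e ; comm = λ _ _ → mk⇔ (λ x → x) (λ x → x) }

module ProductFacts {A B : Hypergraph} (P : Product ℌ A B) where
  open Product P

  vertex-ext : ∀ {v v′} → V⟨ π₁ ⟩ v ≡ V⟨ π₁ ⟩ v′ → V⟨ π₂ ⟩ v ≡ V⟨ π₂ ⟩ v′ →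
               v ≡ v′
  vertex-ext {v} {v′} p₁ p₂ =
    proj₁ (product-ext P {φ = point v} {ψ = point v′}
             ((λ _ → p₁) , λ ()) ((λ _ → p₂) , λ ())) tt

  full-edge-ext : ∀ {w w′} (full : IsFull A×B w) (full′ : IsFull A×B w′) →
                  E⟨ π₁ ⟩ w ≡ E⟨ π₁ ⟩ w′ → E⟨ π₂ ⟩ w ≡ E⟨ π₂ ⟩ w′ → w ≡ w′
  full-edge-ext full full′ p₁ p₂ =
    proj₂ (product-ext P {φ = fullEdge _ full} {ψ = fullEdge _ full′}
             ((λ _ → refl) , λ _ → p₁) ((λ _ → refl) , λ _ → p₂)) tt

Point-product-edgeless : ∀ {A} (P : Product ℌ Point A) → E (Product.A×B P) → ⊥
Point-product-edgeless P = E⟨ Product.π₁ P ⟩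

-- In One × Complete S every edge contains every vertex, so there is only one.
One-product-edge-unique : ∀ {S} (P : Product ℌ One (Complete S)) →
                          (w w′ : E (Product.A×B P)) → w ≡ w′
One-product-edge-unique P w w′ = full-edge-ext (full w) (full w′) refl refl
  where
  open Product P
  open ProductFacts P
  full : ∀ w → IsFull A×B w
  full w v =
    let (u , u∈w , π₂u≡π₂v) = Equivalence.to (comm π₂ w (V⟨ π₂ ⟩ v)) tt
    in subst (ε A×B w) (vertex-ext refl π₂u≡π₂v) u∈w

act : Bool → Hom Edge₂ Edge₂
act b = completeHom (b xor_) tt (λ v _ → b xor v , xor-cancel b v) (λ _ → tt)
  where
  xor-cancel : ∀ b v → b xor (b xor v) ≡ v
  xor-cancel b v = trans (sym (xor-assoc b b v)) (cong (_xor v) (xor-same b))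

-- In Edge₂ × Edge₂ the diagonal edge differs from the antidiagonal one, since
-- only the former contains the vertex (true , true).
diagonal≢antidiagonal : (P : Product ℌ Edge₂ Edge₂) →
  let open Product P in E⟨ ⟨ idH , idH ⟩ ⟩ tt ≡ E⟨ ⟨ idH , act true ⟩ ⟩ tt → ⊥
diagonal≢antidiagonal P diag≡anti =
  let (t , _ , t↦u) = Equivalence.to (comm antidiagonal tt u) u∈anti
  in misses-u t t↦u
  where
  open Product P
  diagonal antidiagonal : Hom Edge₂ A×B
  diagonal = ⟨ idH , idH ⟩
  antidiagonal = ⟨ idH , act true ⟩
  u : V A×B
  u = V⟨ diagonal ⟩ true
  u∈anti : ε A×B (E⟨ antidiagonal ⟩ tt) u
  u∈anti = subst (λ x → ε A×B x u) diag≡anti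
    (Equivalence.from (comm diagonal tt u) (true , tt , refl))
  -- The antidiagonal vertex over t has coordinates (t , not t) ≠ (true , true).
  misses-u : ∀ t → V⟨ antidiagonal ⟩ t ≡ u → ⊥
  misses-u t t↦u = not-¬ refl (trans t≡true (sym not-t≡true))
    where
    t≡true : t ≡ true
    t≡true = trans (sym (proj₁ project₁ t))
      (trans (cong V⟨ π₁ ⟩ t↦u) (proj₁ project₁ true))
    not-t≡true : not t ≡ true
    not-t≡true = trans (sym (proj₁ project₂ t))
      (trans (cong V⟨ π₂ ⟩ t↦u) (proj₁ project₂ true))

module _ (prod : ∀ X Y → Product ℌ X Y) where
  open WithProducts prod

  transpose-constant : ∀ {X A B} (Ex : Exponential ℌ prod A B)
    {f : Hom (Product.A×B (prod X A)) B} (c : V A → V B) →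
    (∀ v → V⟨ f ⟩ v ≡ c (V⟨ π₂ X A ⟩ v)) →
    ∀ x y → V⟨ Exponential.λg Ex f ⟩ x ≡ V⟨ Exponential.λg Ex f ⟩ y
  transpose-constant {X} {A} Ex {f} c f-via-c x y =
    proj₁ (λ-equalises (point x) (point y) same) tt
    where
    open WithExponential Ex
    second-coordinate : ∀ (z : V X) v →
                        V⟨ π₂ X A ⟩ (V⟨ point z ⊗ A ⟩ v) ≡ V⟨ π₂ Point A ⟩ v
    second-coordinate z = proj₁ (project₂ X A)
    same : (f ∘H (point x ⊗ A)) ≈H (f ∘H (point y ⊗ A))
    same = edgeless-ext {φ = f ∘H (point x ⊗ A)} {ψ = f ∘H (point y ⊗ A)}
      (Point-product-edgeless (prod Point A)) λ v →
      trans (f-via-c _)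
        (trans (cong c (trans (second-coordinate x v) (sym (second-coordinate y v))))
               (sym (f-via-c _)))

not-cartesian-closed : ¬ CartesianClosed ℌ
not-cartesian-closed cc =
  diagonal≢antidiagonal P (edges-identified (E⟨ ⟨ idH , idH ⟩ ⟩ tt) (E⟨ ⟨ idH , act true ⟩ ⟩ tt))
  where
  open CartesianClosed cc using (product; exponential)
  open WithProducts product using (_⊗_; module WithExponential)
  P : Product ℌ Edge₂ Edge₂
  P = product Edge₂ Edge₂
  open Product P using (A×B; π₂; ⟨_,_⟩)
  B : Hypergraph
  B = pushV A×B V⟨ π₂ ⟩
  f : Hom A×B B
  f = pushHom A×B V⟨ π₂ ⟩
  Ex : Exponential ℌ product Edge₂ B
  Ex = exponential Edge₂ B
  open Exponential Ex using (B^A; λg; eval)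
  open WithExponential Ex using (β-factor)
  λf-factors : Σ (Hom One B^A) λ k → λg f ≈H (k ∘H !)
  λf-factors = factor-through-One (λg f)
    (transpose-constant product Ex (λ b → b) (λ _ → refl) true false)
  k : Hom One B^A
  k = proj₁ λf-factors
  f-factors : f ≈H ((eval ∘H (k ⊗ Edge₂)) ∘H (! ⊗ Edge₂))
  f-factors = β-factor {f = f} {q = !} {k = k} (proj₂ λf-factors)
  -- f is the identity on edges, yet factors through One × Edge₂, which has
  -- a single edge.
  edges-identified : ∀ x x′ → x ≡ x′
  edges-identified x x′ =
    trans (proj₂ f-factors x)
      (trans (cong E⟨ eval ∘H (k ⊗ Edge₂) ⟩
                   (One-product-edge-unique (product One Edge₂) _ _))
             (sym (proj₂ f-factors x′)))

ℤ₂ : Category 0ℓ 0ℓ 0ℓ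
ℤ₂ = record
  { Obj = ⊤
  ; _⇒_ = λ _ _ → Bool
  ; _≈_ = _≡_
  ; id = false
  ; _∘_ = _xor_
  ; equiv = isEquivalence
  ; ∘-resp-≈ = cong₂ _xor_
  ; identityˡ = refl
  ; identityʳ = λ {_} {_} {f} → xor-identityʳ f
  ; assoc = λ {_} {_} {_} {_} {f} {g} {h} → xor-assoc h g f
  }

SwapAction : Functor ℤ₂ ℌ
SwapAction = record
  { F₀ = λ _ → Edge₂
  ; F₁ = act
  ; identity = (λ _ → refl) , (λ _ → refl)
  ; homomorphism = λ {_} {_} {_} {f} {g} → (λ v → xor-assoc g f v) , (λ _ → refl)
  ; F-resp-≈ = λ { refl → (λ _ → refl) , (λ _ → refl) }
  }

-- The apex of a cone over the swap action has no vertices (each would be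
-- fixed by the swap) and hence no edges (each maps to the nonempty edge).
module SwapCone (K : Cone SwapAction) where
  open Cone K

  no-vertex : V apex → ⊥
  no-vertex v = not-¬ refl (sym (proj₁ (commute {tt} {tt} true) v))

  no-edge : E apex → ⊥
  no-edge e = no-vertex (proj₁ (Equivalence.to (comm (ψ tt) e true) tt))

Empty : Hypergraph
Empty = record { V = ⊥ ; E = ⊥ ; ε = λ () }

EmptyCone : Cone SwapAction
EmptyCone = record
  { apex = Empty
  ; ψ = λ _ → record { V⟨_⟩ = λ () ; E⟨_⟩ = λ () ; comm = λ () }
  ; commute = λ _ → (λ ()) , (λ ())
  }

empty-is-limit : IsLimit SwapAction EmptyCone
empty-is-limit K =
  into-Empty ,
  (λ j → agree (Cone.ψ EmptyCone j ∘H into-Empty) (Cone.ψ K j)) ,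
  (λ h′ _ → agree h′ into-Empty)
  where
  open SwapCone K
  into-Empty : Hom (Cone.apex K) Empty
  into-Empty = record
    { V⟨_⟩ = no-vertex ; E⟨_⟩ = no-edge ; comm = λ e → ⊥-elim (no-edge e) }
  agree : ∀ {Y} (φ ψ : Hom (Cone.apex K) Y) → φ ≈H ψ
  agree _ _ = (λ v → ⊥-elim (no-vertex v)) , (λ e → ⊥-elim (no-edge e))

-- Under E the limit becomes ∅, but the point is a cone over the E-image.
not-continuous : ¬ Continuous EdgeFunctor
not-continuous continuous =
  proj₁ (continuous ℤ₂ SwapAction EmptyCone empty-is-limit point-cone) tt
  where
  point-cone : Cone (EdgeFunctor ∘F SwapAction)
  point-cone = record { apex = ⊤ ; ψ = λ _ _ → tt ; commute = λ _ _ → refl }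

mainTheorem4 : ¬ CartesianClosed ℌ × ¬ Continuous EdgeFunctor
mainTheorem4 = not-cartesian-closed , not-continuous
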